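{- Let $k,r$ be positive integers with $r\le k$, and write $k=\alpha r+\beta$ with integers $\alpha\ge1$, $0\le\beta\le r-1$. Define blocks $B_1,\dots,B_n\subseteq[k]$ as follows. (i) If $\beta=0$ and $n\ge\alpha$: $B_i=[(i-1)r+1,(i-1)r+r]$ for $i\in[\alpha]$, and $B_i=[k]$ for $i\in[\alpha+1,n]$. (ii) If $\beta>0$ and $n\ge\alpha+r$: $B_i=[(i-1)r+1,(i-1)r+r]$ for $i\in[\alpha]$; $B_i=[k]\setminus\{i-\alpha,\,i-\alpha+r,\,i-\alpha+2r,\dots,i-\alpha+(\alpha-1)r\}$ for $i\in[\alpha+1,\alpha+r]$; and $B_i=[k]$ for $i\in[\alpha+r+1,n]$. For $j\in[k]$ let $C_j=\{i\in[n]: j\in B_i\}$. Then in either case $\{C_1,\dots,C_k\}$ is an $(n,N,k,k;r)$-MCBC with $N=kn-\left\lfloor\frac{k-1}{r}\right\rfloor k$.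
   Context: An $(n,N,k,m;r)$ multiset combinatorial batch code (MCBC) is a collection $\mathcal C=\{C_1,\dots,C_m\}$ of subsets of $[n]=\{1,\dots,n\}$ (servers) with $N=\sum_{j=1}^m|C_j|$, such that for every multiset request $\{i_1,\dots,i_k\}$ of $k$ elements of $[n]$ in which every element has multiplicity at most $r$, there exist subsets $D_j\subseteq C_j$ with $|D_j|\le 1$ ($j\in[m]$) whose multiset union (the multiplicity of $i$ being $|\{j: i\in D_j\}|$) contains the request. For integers $a\le b$, $[a,b]=\{a,a+1,\dots,b\}$ and $[a]=[1,a]$. -}

module Defs where

open import Data.Bool using (Bool; true; false; if_then_else_; _∧_; not)
open import Data.Nat using (ℕ; zero; suc; _+_; _*_; _∸_; _≤_; _≤ᵇ_; _≡ᵇ_)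
open import Data.Fin using (Fin; toℕ; _≟_)
open import Data.Fin.Subset using (Subset; _∈_; ∣_∣)
open import Data.Vec using (tabulate)
open import Data.List using (upTo)
open import Data.Bool.ListAction using (any)
open import Data.Maybe using (Maybe; just; nothing)
open import Data.Product using (_×_; ∃)
open import Relation.Nullary using (does)
open import Relation.Binary.PropositionalEquality using (_≡_)

sumFin : (m : ℕ) → (Fin m → ℕ) → ℕ
sumFin zero f = 0
sumFin (suc m) f = f Fin.zero + sumFin m (λ i → f (Fin.suc i))

-- contribution of a chosen D_j (|D_j| ≤ 1, encoded as Maybe) to the multiplicity of i
hit : {n : ℕ} → Maybe (Fin n) → Fin n → ℕ
hit nothing i = 0
hit (just x) i = if does (x ≟ i) then 1 else 0

count : {n m : ℕ} → (Fin m → Maybe (Fin n)) → Fin n → ℕ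
count {m = m} D i = sumFin m (λ j → hit (D j) i)

-- A multiset request of k elements of [n] is a multiplicity function req with
-- Σ req = k and every multiplicity ≤ r.
MCBC : (n N k m r : ℕ) → (Fin m → Subset n) → Set
MCBC n N k m r C =
  (N ≡ sumFin m (λ j → ∣ C j ∣)) ×
  ((req : Fin n → ℕ) → sumFin n req ≡ k → (∀ i → req i ≤ r) →
    ∃ λ (D : Fin m → Maybe (Fin n)) →
      (∀ j i → D j ≡ just i → i ∈ C j) × (∀ i → req i ≤ count D i))

-- Membership j ∈ B_i (1-indexed i ∈ [n], j ∈ [k]); parameters α r.
-- j ∈ [(i-1)r+1, (i-1)r+r]
inInterval : (r i j : ℕ) → Bool
inInterval r i j = ((i ∸ 1) * r + 1 ≤ᵇ j) ∧ (j ≤ᵇ (i ∸ 1) * r + r)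

blockI : (α r i j : ℕ) → Bool
blockI α r i j = if i ≤ᵇ α then inInterval r i j else true

inExcl : (α r i j : ℕ) → Bool
inExcl α r i j = any (λ t → j ≡ᵇ (i ∸ α) + t * r) (upTo α)

blockII : (α r i j : ℕ) → Bool
blockII α r i j =
  if i ≤ᵇ α then inInterval r i j
  else (if i ≤ᵇ α + r then not (inExcl α r i j) else true)

-- C_j = { i ∈ [n] : j ∈ B_i }, for j : Fin k (element toℕ j + 1), i : Fin n (server toℕ i + 1)
codeOf : (n k : ℕ) → (ℕ → ℕ → Bool) → Fin k → Subset n
codeOf n k B j = tabulate (λ i → B (toℕ i + 1) (toℕ j + 1))

module Submission where

-- Number the servers 0,…,n-1 and the elements 0,…,k-1 (element y is j = y+1 of
-- the paper) and view the first αr elements as an α × r grid, element t·r+x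
-- lying in row t and column x.  In both constructions server t < α holds row t
-- ("block servers"), the servers α ≤ i < α + sp hold every grid element outside
-- column i-α ("special servers"; sp = 0 in case (i), sp = r in case (ii)), every
-- server i ≥ α holds the β tail elements, and servers i ≥ α + sp hold everything.
--
-- A request is recovered greedily: the elements are visited in the order
-- 0,1,…,k-1 and each one is given to a server that still has demand, keeping an
-- invariant ('Inv') which guarantees that the next element can be served as well
-- ('greedy-cover').  The choice rule for a grid element (t,x) is: serve block t if
-- it cannot wait any longer, otherwise serve a special or full server (preferring
-- special servers with demand ≥ 2), otherwise block t.

open import Defs
open import Data.Bool using (Bool; true; false; if_then_else_; _∧_; not; T)
open import Data.Bool.Properties using (∧-zeroʳ; ∨-zeroʳ)
open import Data.Bool.ListAction using (any)
open import Data.Empty using (⊥-elim)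
open import Data.Fin using (Fin; toℕ; fromℕ<) renaming (zero to fz; suc to fs; _≟_ to _≟ᶠ_)
open import Data.Fin.Properties using (toℕ-injective; toℕ-fromℕ<; toℕ<n; any?) renaming (suc-injective to fs-injective)
open import Data.Fin.Subset using (Subset; _∈_; ∣_∣)
open import Data.List using (applyUpTo)
open import Data.Maybe using (Maybe; just; nothing)
open import Data.Nat
open import Data.Nat.DivMod
open import Data.Nat.Divisibility using (divides)
open import Data.Nat.Properties
open import Algebra.Properties.CommutativeSemigroup +-commutativeSemigroup using (interchange)
open import Data.Nat.Tactic.RingSolver using (solve-∀)
open import Data.Product using (_×_; _,_; ∃; ∃₂)
open import Data.Sum using (_⊎_; inj₁; inj₂; [_,_]′)
open import Data.Unit using (tt)
open import Data.Vec using (tabulate)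
open import Data.Vec.Properties using (lookup∘tabulate; lookup⇒[]=)
open import Relation.Binary.Definitions using (tri<; tri≈; tri>)
open import Relation.Binary.PropositionalEquality
open import Relation.Nullary using (does; yes; no; ¬_; Dec)
open import Relation.Nullary.Decidable using (_×-dec_; ¬?)

sumFin-cong : ∀ n {f g : Fin n → ℕ} → (∀ i → f i ≡ g i) → sumFin n f ≡ sumFin n g
sumFin-cong zero e = refl
sumFin-cong (suc n) e = cong₂ _+_ (e fz) (sumFin-cong n (λ i → e (fs i)))

sumFin-mono : ∀ n {f g : Fin n → ℕ} → (∀ i → f i ≤ g i) → sumFin n f ≤ sumFin n g
sumFin-mono zero e = ≤-refl
sumFin-mono (suc n) e = +-mono-≤ (e fz) (sumFin-mono n (λ i → e (fs i)))

sumFin-+ : ∀ n (f g : Fin n → ℕ) → sumFin n (λ i → f i + g i) ≡ sumFin n f + sumFin n g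
sumFin-+ zero f g = refl
sumFin-+ (suc n) f g =
  trans (cong ((f fz + g fz) +_) (sumFin-+ n (λ i → f (fs i)) (λ i → g (fs i))))
        (interchange (f fz) (g fz) _ _)

sumFin-zero : ∀ n {f : Fin n → ℕ} → (∀ i → f i ≡ 0) → sumFin n f ≡ 0
sumFin-zero zero e = refl
sumFin-zero (suc n) e = cong₂ _+_ (e fz) (sumFin-zero n (λ i → e (fs i)))

sumFin-const : ∀ n c → sumFin n (λ _ → c) ≡ n * c
sumFin-const zero c = refl
sumFin-const (suc n) c = cong (c +_) (sumFin-const n c)

sumFin-point : ∀ n (f : Fin n → ℕ) c → f c ≤ sumFin n f
sumFin-point (suc n) f fz = m≤m+n (f fz) _
sumFin-point (suc n) f (fs c) = ≤-trans (sumFin-point n (λ i → f (fs i)) c) (m≤n+m _ (f fz))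

sumFin-two : ∀ n (f : Fin n → ℕ) c u → c ≢ u → f c + f u ≤ sumFin n f
sumFin-two (suc n) f fz fz c≢u = ⊥-elim (c≢u refl)
sumFin-two (suc n) f fz (fs u) _ = +-monoʳ-≤ (f fz) (sumFin-point n (λ i → f (fs i)) u)
sumFin-two (suc n) f (fs c) fz _ = subst (_≤ sumFin (suc n) f) (+-comm (f fz) (f (fs c)))
  (+-monoʳ-≤ (f fz) (sumFin-point n (λ i → f (fs i)) c))
sumFin-two (suc n) f (fs c) (fs u) c≢u =
  ≤-trans (sumFin-two n (λ i → f (fs i)) c u (λ e → c≢u (cong fs e))) (m≤n+m _ (f fz))

sumFin-single : ∀ n (f : Fin n → ℕ) c → (∀ i → i ≢ c → f i ≡ 0) → sumFin n f ≡ f c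
sumFin-single (suc n) f fz e =
  trans (cong (f fz +_) (sumFin-zero n (λ i → e (fs i) (λ ())))) (+-identityʳ _)
sumFin-single (suc n) f (fs c) e =
  cong₂ _+_ (e fz (λ ())) (sumFin-single n (λ i → f (fs i)) c (λ i i≢c → e (fs i) (λ q → i≢c (fs-injective q))))

sumFin-pos : ∀ n (f : Fin n → ℕ) → 0 < sumFin n f → ∃ λ i → 0 < f i
sumFin-pos zero f ()
sumFin-pos (suc n) f pos with 0 <? f fz
... | yes f0>0 = fz , f0>0
... | no f0≯0 with sumFin-pos n (λ i → f (fs i)) (subst (λ z → 0 < z + sumFin n (λ i → f (fs i))) (n≤0⇒n≡0 (≮⇒≥ f0≯0)) pos)
...   | i , fi>0 = fs i , fi>0

sumFin-hit : ∀ n (s : Fin n) → sumFin n (hit (just s)) ≡ 1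
sumFin-hit (suc n) fz = cong suc (sumFin-zero n (λ i → refl))
sumFin-hit (suc n) (fs s) = sumFin-hit n s

-- Sums over the indices 0,…,m-1 of a function on ℕ; the counting of |C_j| is done
-- with these, since splitting the index range is easier on ℕ than on Fin.
sumℕ : ℕ → (ℕ → ℕ) → ℕ
sumℕ zero h = 0
sumℕ (suc m) h = h 0 + sumℕ m (λ i → h (suc i))

sumFin-toℕ : ∀ n (h : ℕ → ℕ) → sumFin n (λ i → h (toℕ i)) ≡ sumℕ n h
sumFin-toℕ zero h = refl
sumFin-toℕ (suc n) h = cong (h 0 +_) (sumFin-toℕ n (λ i → h (suc i)))

sumℕ-cong : ∀ m {h g : ℕ → ℕ} → (∀ i → h i ≡ g i) → sumℕ m h ≡ sumℕ m g
sumℕ-cong zero e = refl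
sumℕ-cong (suc m) e = cong₂ _+_ (e 0) (sumℕ-cong m (λ i → e (suc i)))

sumℕ-+ : ∀ m (f g : ℕ → ℕ) → sumℕ m (λ i → f i + g i) ≡ sumℕ m f + sumℕ m g
sumℕ-+ m f g = begin
  sumℕ m (λ i → f i + g i)                                ≡⟨ sumFin-toℕ m _ ⟨
  sumFin m (λ i → f (toℕ i) + g (toℕ i))                  ≡⟨ sumFin-+ m _ _ ⟩
  sumFin m (λ i → f (toℕ i)) + sumFin m (λ i → g (toℕ i)) ≡⟨ cong₂ _+_ (sumFin-toℕ m f) (sumFin-toℕ m g) ⟩
  sumℕ m f + sumℕ m g                                     ∎
  where open ≡-Reasoning

sumℕ-split : ∀ a b (h : ℕ → ℕ) → sumℕ (a + b) h ≡ sumℕ a h + sumℕ b (λ i → h (a + i))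
sumℕ-split zero b h = refl
sumℕ-split (suc a) b h =
  trans (cong (h 0 +_) (sumℕ-split a b (λ i → h (suc i)))) (sym (+-assoc (h 0) _ _))

sumℕ-const : ∀ m c (h : ℕ → ℕ) → (∀ i → i < m → h i ≡ c) → sumℕ m h ≡ m * c
sumℕ-const zero c h e = refl
sumℕ-const (suc m) c h e =
  cong₂ _+_ (e 0 z<s) (sumℕ-const m c (λ i → h (suc i)) (λ i i<m → e (suc i) (s<s i<m)))

T⇒≡true : ∀ {b} → T b → b ≡ true
T⇒≡true {true} _ = refl

¬T⇒≡false : ∀ {b} → ¬ T b → b ≡ false
¬T⇒≡false {true} p = ⊥-elim (p tt)
¬T⇒≡false {false} p = refl

≤ᵇ-true : ∀ {m n} → m ≤ n → (m ≤ᵇ n) ≡ true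
≤ᵇ-true m≤n = T⇒≡true (≤⇒≤ᵇ m≤n)

≤ᵇ-false : ∀ {m n} → n < m → (m ≤ᵇ n) ≡ false
≤ᵇ-false {m} {n} n<m = ¬T⇒≡false (λ q → <⇒≱ n<m (≤ᵇ⇒≤ m n q))

<ᵇ-true : ∀ {m n} → m < n → (m <ᵇ n) ≡ true
<ᵇ-true m<n = T⇒≡true (<⇒<ᵇ m<n)

<ᵇ-false : ∀ {m n} → n ≤ m → (m <ᵇ n) ≡ false
<ᵇ-false {m} {n} n≤m = ¬T⇒≡false (λ q → <⇒≱ (<ᵇ⇒< m n q) n≤m)

≡ᵇ-refl : ∀ m → (m ≡ᵇ m) ≡ true
≡ᵇ-refl m = T⇒≡true (≡⇒≡ᵇ m m refl)

≡ᵇ-false : ∀ {m n} → m ≢ n → (m ≡ᵇ n) ≡ false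
≡ᵇ-false {m} {n} m≢n = ¬T⇒≡false (λ q → m≢n (≡ᵇ⇒≡ m n q))

suc-∸1 : ∀ {m} → 1 ≤ m → suc (m ∸ 1) ≡ m
suc-∸1 (s≤s z≤n) = refl

suc≤+1⇒≤ : ∀ {a b} → suc a ≤ b + 1 → a ≤ b
suc≤+1⇒≤ {a} {b} p = ≤-pred (subst (suc a ≤_) (+-comm b 1) p)

serve : {n : ℕ} → Maybe (Fin n) → (Fin n → ℕ) → Fin n → ℕ
serve nothing req i = req i
serve (just s) req i = if does (s ≟ᶠ i) then req i ∸ 1 else req i

serve-≤ : {n : ℕ} (o : Maybe (Fin n)) (req : Fin n → ℕ) (i : Fin n) → serve o req i ≤ req i
serve-≤ nothing req i = ≤-refl
serve-≤ (just s) req i with s ≟ᶠ i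
... | yes _ = m∸n≤m (req i) 1
... | no _ = ≤-refl

serve-covers : {n : ℕ} (o : Maybe (Fin n)) (req : Fin n → ℕ) (i : Fin n) → req i ≤ hit o i + serve o req i
serve-covers nothing req i = ≤-refl
serve-covers (just s) req i with s ≟ᶠ i
... | yes _ = m≤n+m∸n (req i) 1
... | no _ = ≤-refl

greedy-cover : {n : ℕ} (K : ℕ) (C : ℕ → Subset n) (Inv : ℕ → (Fin n → ℕ) → Set)
  (step : ∀ j req → j < K → Inv j req →
     ∃ λ (o : Maybe (Fin n)) → (∀ i → o ≡ just i → i ∈ C j) × Inv (suc j) (serve o req))
  (done : ∀ req → Inv K req → ∀ i → req i ≡ 0)
  → ∀ m j req → j + m ≡ K → Inv j req →
  ∃ λ (D : Fin m → Maybe (Fin n)) → (∀ e i → D e ≡ just i → i ∈ C (j + toℕ e)) × (∀ i → req i ≤ count D i)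
greedy-cover K C Inv step done zero j req j+0≡K inv =
  (λ ()) , (λ ()) , λ i → ≤-reflexive (done req (subst (λ z → Inv z req) (trans (sym (+-identityʳ j)) j+0≡K) inv) i)
greedy-cover {n} K C Inv step done (suc m) j req j+m≡K inv
  with step j req (subst (j <_) j+m≡K (m<m+n j z<s)) inv
... | o , member , inv'
  with greedy-cover K C Inv step done m (suc j) (serve o req) (trans (sym (+-suc j m)) j+m≡K) inv'
...   | D , memberD , covered =
  D' , member' , λ i → ≤-trans (serve-covers o req i) (+-monoʳ-≤ (hit o i) (covered i))
  where
  D' : Fin (suc m) → Maybe (Fin n)
  D' fz = o
  D' (fs e) = D e
  member' : ∀ e i → D' e ≡ just i → i ∈ C (j + toℕ e)
  member' fz i p = subst (λ z → i ∈ C z) (sym (+-identityʳ j)) (member i p)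
  member' (fs e) i p = subst (λ z → i ∈ C z) (sym (+-suc j (toℕ e))) (memberD e i p)

module Layout (n k r α β sp : ℕ) (k≡ : k ≡ α * r + β) (sp≤r : sp ≤ r) (sp-needs-β : sp ≡ 0 ⊎ 1 ≤ β)
  (α+sp≤n : α + sp ≤ n) (0<α : 0 < α) (0<r : 0 < r) (C : ℕ → Subset n)
  (block∈ : ∀ (i : Fin n) t x → toℕ i ≡ t → t < α → x < r → i ∈ C (t * r + x))
  (special∈ : ∀ (i : Fin n) t x → α ≤ toℕ i → toℕ i < α + sp → t < α → x < r → toℕ i ≢ α + x →
              i ∈ C (t * r + x))
  (tail∈ : ∀ (i : Fin n) y → α ≤ toℕ i → α * r ≤ y → y < k → i ∈ C y)
  (full∈ : ∀ (i : Fin n) y → α + sp ≤ toℕ i → y < k → i ∈ C y)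
  where

  inner : (Fin n → ℕ) → Fin n → ℕ
  inner req i = if α ≤ᵇ toℕ i then 0 else req i

  outer : (Fin n → ℕ) → Fin n → ℕ
  outer req i = if α ≤ᵇ toℕ i then req i else 0

  outerDemand : (Fin n → ℕ) → ℕ
  outerDemand req = sumFin n (outer req)

  outer-≥α : ∀ req i → α ≤ toℕ i → outer req i ≡ req i
  outer-≥α req i p rewrite ≤ᵇ-true p = refl

  outer-<α : ∀ req i → toℕ i < α → outer req i ≡ 0
  outer-<α req i p rewrite ≤ᵇ-false p = refl

  inner-≥α : ∀ req i → α ≤ toℕ i → inner req i ≡ 0
  inner-≥α req i p rewrite ≤ᵇ-true p = refl

  inner-<α : ∀ req i → toℕ i < α → inner req i ≡ req i
  inner-<α req i p rewrite ≤ᵇ-false p = refl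

  demand-split : ∀ req → sumFin n req ≡ sumFin n (inner req) + outerDemand req
  demand-split req = trans (sumFin-cong n pointwise) (sumFin-+ n (inner req) (outer req))
    where
    pointwise : ∀ i → req i ≡ inner req i + outer req i
    pointwise i with α ≤? toℕ i
    ... | yes p rewrite inner-≥α req i p | outer-≥α req i p = refl
    ... | no p rewrite inner-<α req i (≰⇒> p) | outer-<α req i (≰⇒> p) = sym (+-identityʳ _)

  serve-at : ∀ (req : Fin n → ℕ) s → serve (just s) req s ≡ req s ∸ 1
  serve-at req s with s ≟ᶠ s
  ... | yes _ = refl
  ... | no s≢s = ⊥-elim (s≢s refl)

  serve-off : ∀ (req : Fin n → ℕ) s i → s ≢ i → serve (just s) req i ≡ req i
  serve-off req s i s≢i with s ≟ᶠ i
  ... | yes s≡i = ⊥-elim (s≢i s≡i)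
  ... | no _ = refl

  total-served : ∀ (req : Fin n → ℕ) s → 1 ≤ req s → sumFin n (serve (just s) req) + 1 ≡ sumFin n req
  total-served req s p = begin
    sumFin n (serve (just s) req) + 1                                  ≡⟨ cong (sumFin n (serve (just s) req) +_) (sumFin-hit n s) ⟨
    sumFin n (serve (just s) req) + sumFin n (hit (just s))            ≡⟨ sumFin-+ n _ _ ⟨
    sumFin n (λ i → serve (just s) req i + hit (just s) i)             ≡⟨ sumFin-cong n pointwise ⟩
    sumFin n req                                                       ∎
    where
    open ≡-Reasoning
    pointwise : ∀ i → serve (just s) req i + hit (just s) i ≡ req i
    pointwise i with s ≟ᶠ i
    ... | yes refl = m∸n+n≡m p
    ... | no _ = +-identityʳ _

  outerDemand-served-outer : ∀ (req : Fin n → ℕ) s → α ≤ toℕ s → 1 ≤ req s →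
    outerDemand (serve (just s) req) + 1 ≡ outerDemand req
  outerDemand-served-outer req s α≤s p = begin
    outerDemand (serve (just s) req) + 1                                ≡⟨ cong (outerDemand (serve (just s) req) +_) (sumFin-hit n s) ⟨
    outerDemand (serve (just s) req) + sumFin n (hit (just s))          ≡⟨ sumFin-+ n _ _ ⟨
    sumFin n (λ i → outer (serve (just s) req) i + hit (just s) i)      ≡⟨ sumFin-cong n pointwise ⟩
    outerDemand req                                                     ∎
    where
    open ≡-Reasoning
    pointwise : ∀ i → outer (serve (just s) req) i + hit (just s) i ≡ outer req i
    pointwise i with s ≟ᶠ i
    ... | yes refl rewrite ≤ᵇ-true α≤s = m∸n+n≡m p
    ... | no _ = +-identityʳ _

  outerDemand-served-block : ∀ (req : Fin n → ℕ) s → toℕ s < α → outerDemand (serve (just s) req) ≡ outerDemand req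
  outerDemand-served-block req s s<α = sumFin-cong n pointwise
    where
    pointwise : ∀ i → outer (serve (just s) req) i ≡ outer req i
    pointwise i with s ≟ᶠ i
    ... | yes refl rewrite ≤ᵇ-false s<α = refl
    ... | no _ = refl

  -- While row t is being served, the block servers before t are done, block t
  -- still needs some a, and every later block needs at most r.  'blockCap t a'
  -- is the resulting pointwise cap on the block part of the request.
  blockCap : ℕ → ℕ → ℕ → ℕ
  blockCap t a i = if i <ᵇ t then 0 else (if i ≡ᵇ t then a else (if i <ᵇ α then r else 0))

  blockCap-before : ∀ t a i → i < t → blockCap t a i ≡ 0
  blockCap-before t a i p rewrite <ᵇ-true p = refl

  blockCap-at : ∀ t a → blockCap t a t ≡ a
  blockCap-at t a rewrite <ᵇ-false (≤-refl {t}) | ≡ᵇ-refl t = refl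

  blockCap-between : ∀ t a i → t < i → i < α → blockCap t a i ≡ r
  blockCap-between t a i p q rewrite <ᵇ-false (<⇒≤ p) | ≡ᵇ-false (>⇒≢ p) | <ᵇ-true q = refl

  blockCap-after : ∀ t a i → t < i → α ≤ i → blockCap t a i ≡ 0
  blockCap-after t a i p q rewrite <ᵇ-false (<⇒≤ p) | ≡ᵇ-false (>⇒≢ p) | <ᵇ-false q = refl

  blockCap-sum : ∀ t a → t < α → sumℕ n (blockCap t a) ≡ a + (α ∸ suc t) * r
  blockCap-sum t a t<α = begin
    sumℕ n cap                                                        ≡⟨ cong (λ z → sumℕ z cap) n≡ ⟩
    sumℕ (t + suc (u + w)) cap                                        ≡⟨ sumℕ-split t (suc (u + w)) cap ⟩
    sumℕ t cap + (cap (t + 0) + sumℕ (u + w) (λ i → cap (t + suc i)))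
      ≡⟨ cong₂ (λ p q → p + (q + sumℕ (u + w) (λ i → cap (t + suc i)))) before at ⟩
    0 + (a + sumℕ (u + w) (λ i → cap (t + suc i)))                    ≡⟨ cong (a +_) (sumℕ-split u w _) ⟩
    a + (sumℕ u (λ i → cap (t + suc i)) + sumℕ w (λ i → cap (t + suc (u + i))))
      ≡⟨ cong₂ (λ p q → a + (p + q)) between after ⟩
    a + (u * r + w * 0)                                               ≡⟨ cong (λ z → a + (u * r + z)) (*-zeroʳ w) ⟩
    a + (u * r + 0)                                                   ≡⟨ cong (a +_) (+-identityʳ _) ⟩
    a + u * r                                                         ∎
    where
    open ≡-Reasoning
    cap : ℕ → ℕ
    cap = blockCap t a
    u w : ℕ
    u = α ∸ suc t
    w = n ∸ α
    α≡ : suc t + u ≡ α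
    α≡ = m+[n∸m]≡n t<α
    n≡ : n ≡ t + suc (u + w)
    n≡ = sym (begin
      t + suc (u + w)   ≡⟨ +-suc t (u + w) ⟩
      suc t + (u + w)   ≡⟨ +-assoc (suc t) u w ⟨
      suc t + u + w     ≡⟨ cong (_+ w) α≡ ⟩
      α + w             ≡⟨ m+[n∸m]≡n (≤-trans (m≤m+n α sp) α+sp≤n) ⟩
      n                 ∎)
    before : sumℕ t cap ≡ 0
    before = trans (sumℕ-const t 0 cap (λ i p → blockCap-before t a i p)) (*-zeroʳ t)
    at : cap (t + 0) ≡ a
    at = trans (cong cap (+-identityʳ t)) (blockCap-at t a)
    between : sumℕ u (λ i → cap (t + suc i)) ≡ u * r
    between = sumℕ-const u r _ (λ i i<u → blockCap-between t a (t + suc i)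
      (subst (t <_) (sym (+-suc t i)) (s≤s (m≤m+n t i)))
      (subst (_< α) (sym (+-suc t i)) (subst (suc t + i <_) α≡ (+-monoʳ-< (suc t) i<u))))
    after : sumℕ w (λ i → cap (t + suc (u + i))) ≡ w * 0
    after = sumℕ-const w 0 _ (λ i _ → blockCap-after t a (t + suc (u + i))
      (subst (t <_) (sym (+-suc t (u + i))) (s≤s (m≤m+n t (u + i))))
      (subst (_≤ t + suc (u + i)) α≡
        (≤-trans (m≤m+n (suc t + u) i) (≤-reflexive (trans (+-assoc (suc t) u i) (sym (+-suc t (u + i))))))))

  inner-bound : ∀ req t (c : Fin n) → toℕ c ≡ t → t < α → (∀ i → toℕ i < t → req i ≡ 0) →
    (∀ i → req i ≤ r) → sumFin n (inner req) ≤ req c + (α ∸ suc t) * r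
  inner-bound req t c c≡t t<α done bounded =
    ≤-trans (sumFin-mono n capped) (≤-reflexive (trans (sumFin-toℕ n (blockCap t (req c))) (blockCap-sum t (req c) t<α)))
    where
    capped : ∀ i → inner req i ≤ blockCap t (req c) (toℕ i)
    capped i with toℕ i <? α
    ... | no i≮α rewrite inner-≥α req i (≮⇒≥ i≮α) = z≤n
    ... | yes i<α rewrite inner-<α req i i<α with toℕ i <? t
    ...   | yes i<t rewrite done i i<t = z≤n
    ...   | no i≮t with toℕ i ≟ t
    ...     | yes i≡t rewrite toℕ-injective {i = i} {j = c} (trans i≡t (sym c≡t)) | c≡t | blockCap-at t (req c) = ≤-refl
    ...     | no i≢t rewrite blockCap-between t (req c) (toℕ i) (≤∧≢⇒< (≮⇒≥ i≮t) (λ z → i≢t (sym z))) i<α = bounded i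

  -- Counting the elements still to come: at element (t,x) the outer servers must
  -- absorb at least r + β - x - req(t) of them.
  outer-lower-bound : ∀ req t x (c : Fin n) → toℕ c ≡ t → t < α → (∀ i → toℕ i < t → req i ≡ 0) →
    (∀ i → req i ≤ r) → sumFin n req + (t * r + x) ≡ k → r + β ≤ outerDemand req + req c + x
  outer-lower-bound req t x c c≡t t<α done bounded total = +-cancelˡ-≤ (u * r + t * r) _ _ (begin
    u * r + t * r + (r + β)                          ≡⟨ lhs u t r β ⟩
    (suc t + u) * r + β                              ≡⟨ cong (λ z → z * r + β) (m+[n∸m]≡n t<α) ⟩
    α * r + β                                        ≡⟨ trans total k≡ ⟨
    sumFin n req + (t * r + x)                       ≡⟨ cong (_+ (t * r + x)) (demand-split req) ⟩
    sumFin n (inner req) + D + (t * r + x)           ≤⟨ +-monoˡ-≤ (t * r + x) (+-monoˡ-≤ D (inner-bound req t c c≡t t<α done bounded)) ⟩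
    req c + u * r + D + (t * r + x)                  ≡⟨ rhs (req c) u r D t x ⟩
    u * r + t * r + (D + req c + x)                  ∎)
    where
    open ≤-Reasoning
    u D : ℕ
    u = α ∸ suc t
    D = outerDemand req
    lhs : ∀ u t r β → u * r + t * r + (r + β) ≡ (suc t + u) * r + β
    lhs = solve-∀
    rhs : ∀ a u r D t x → a + u * r + D + (t * r + x) ≡ u * r + t * r + (D + a + x)
    rhs = solve-∀

  -- The invariant while element (t,x) is next: earlier blocks are done, block t
  -- can still be served within the remaining r - x columns of its row, and, once
  -- block t is done, every special server whose forbidden column x' ≥ x is still
  -- ahead shares the outer demand with another server.
  record Row (t x : ℕ) (req : Fin n → ℕ) : Set where
    field
      t<α : t < α
      bounded : ∀ i → req i ≤ r
      earlier-done : ∀ i → toℕ i < t → req i ≡ 0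
      block-fits : ∀ i → toℕ i ≡ t → req i + x ≤ r
      special-shared : (∀ c → toℕ c ≡ t → req c ≡ 0) →
        ∀ i → α + x ≤ toℕ i → toℕ i < α + sp → req i < outerDemand req

  Inv : ℕ → (Fin n → ℕ) → Set
  Inv j req = (sumFin n req + j ≡ k) ×
    ((∃₂ λ t x → j ≡ t * r + x × x < r × Row t x req) ⊎ (α * r ≤ j × (∀ i → toℕ i < α → req i ≡ 0)))

  row<n : ∀ {t} → t < α → t < n
  row<n t<α = <-≤-trans t<α (≤-trans (m≤m+n α sp) α+sp≤n)

  grid<k : ∀ t x → t < α → x < r → t * r + x < k
  grid<k t x t<α x<r = begin-strict
    t * r + x    <⟨ +-monoʳ-< (t * r) x<r ⟩
    t * r + r    ≡⟨ +-comm (t * r) r ⟩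
    suc t * r    ≤⟨ *-monoˡ-≤ r t<α ⟩
    α * r        ≤⟨ m≤m+n (α * r) β ⟩
    α * r + β    ≡⟨ k≡ ⟨
    k            ∎
    where open ≤-Reasoning

  special⇒β>0 : ∀ {y} → α ≤ y → y < α + sp → 1 ≤ β
  special⇒β>0 {y} α≤y y<α+sp = [ no-specials , (λ β>0 → β>0) ]′ sp-needs-β
    where
    no-specials : sp ≡ 0 → 1 ≤ β
    no-specials sp≡0 = ⊥-elim (<⇒≱ y<α+sp (subst (_≤ y) (sym (trans (cong (α +_) sp≡0) (+-identityʳ α))) α≤y))

  special-after : ∀ {x y} → α + suc x ≤ y → y < α + sp → 2 + x ≤ r
  special-after {x} p q =
    ≤-trans (+-cancelˡ-≤ α _ _ (subst (_≤ α + sp) (sym (+-suc α (suc x))) (≤-<-trans p q))) sp≤r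

  -- At the start of a row the last clause of 'Row' holds whenever a special server
  -- exists: its demand is ≤ r < r + β ≤ outer demand.
  row-start : ∀ req t → t < α → (∀ i → req i ≤ r) → (∀ i → toℕ i < t → req i ≡ 0) →
    sumFin n req + (t * r + 0) ≡ k → (∀ c → toℕ c ≡ t → req c ≡ 0) →
    ∀ i → α + 0 ≤ toℕ i → toℕ i < α + sp → req i < outerDemand req
  row-start req t t<α bounded done total block-done i α≤i i<α+sp = begin-strict
    req i                               <⟨ s≤s (bounded i) ⟩
    suc r                               ≡⟨ +-comm 1 r ⟩
    r + 1                               ≤⟨ +-monoʳ-≤ r (special⇒β>0 (subst (_≤ toℕ i) (+-identityʳ α) α≤i) i<α+sp) ⟩
    r + β                               ≤⟨ outer-lower-bound req t 0 c c≡t t<α done bounded total ⟩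
    outerDemand req + req c + 0         ≡⟨ cong (λ z → outerDemand req + z + 0) (block-done c c≡t) ⟩
    outerDemand req + 0 + 0             ≡⟨ trans (+-identityʳ _) (+-identityʳ _) ⟩
    outerDemand req                     ∎
    where
    open ≤-Reasoning
    c : Fin n
    c = fromℕ< (row<n t<α)
    c≡t : toℕ c ≡ t
    c≡t = toℕ-fromℕ< (row<n t<α)

  Served : ℕ → ℕ → (Fin n → ℕ) → Maybe (Fin n) → Set
  Served t x req o = (∀ i → o ≡ just i → i ∈ C (t * r + x)) × Row t (suc x) (serve o req) ×
                     (sumFin n (serve o req) + (t * r + suc x) ≡ k)

  module GridStep (t x : ℕ) (req : Fin n → ℕ) (x<r : x < r) (R : Row t x req)
                  (total : sumFin n req + (t * r + x) ≡ k) where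
    open Row R

    c : Fin n
    c = fromℕ< (row<n t<α)

    c≡t : toℕ c ≡ t
    c≡t = toℕ-fromℕ< (row<n t<α)

    is-c : ∀ i → toℕ i ≡ t → i ≡ c
    is-c i i≡t = toℕ-injective (trans i≡t (sym c≡t))

    c<α : toℕ c < α
    c<α = subst (_< α) (sym c≡t) t<α

    a : ℕ
    a = req c

    a+x≤r : a + x ≤ r
    a+x≤r = block-fits c c≡t

    lower : r + β ≤ outerDemand req + a + x
    lower = outer-lower-bound req t x c c≡t t<α earlier-done bounded total

    outer≢c : ∀ i → α ≤ toℕ i → c ≢ i
    outer≢c i α≤i c≡i = <⇒≱ c<α (subst (λ z → α ≤ toℕ z) (sym c≡i) α≤i)

    bounded′ : ∀ o i → serve o req i ≤ r
    bounded′ o i = ≤-trans (serve-≤ o req i) (bounded i)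

    earlier-done′ : ∀ o i → toℕ i < t → serve o req i ≡ 0
    earlier-done′ o i i<t = n≤0⇒n≡0 (≤-trans (serve-≤ o req i) (≤-reflexive (earlier-done i i<t)))

    total′ : ∀ w → 1 ≤ req w → sumFin n (serve (just w) req) + (t * r + suc x) ≡ k
    total′ w p = begin
      S′ + (t * r + suc x)     ≡⟨ cong (S′ +_) (+-suc (t * r) x) ⟩
      S′ + suc (t * r + x)     ≡⟨ +-suc S′ (t * r + x) ⟩
      suc S′ + (t * r + x)     ≡⟨ cong (_+ (t * r + x)) (trans (+-comm 1 S′) (total-served req w p)) ⟩
      sumFin n req + (t * r + x) ≡⟨ total ⟩
      k                        ∎
      where
      open ≡-Reasoning
      S′ : ℕ
      S′ = sumFin n (serve (just w) req)

    c∈ : ∀ i → just c ≡ just i → i ∈ C (t * r + x)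
    c∈ i refl = block∈ c t x c≡t t<α x<r

    block-fits-after-c : 1 ≤ a → ∀ i → toℕ i ≡ t → serve (just c) req i + suc x ≤ r
    block-fits-after-c a≥1 i i≡t rewrite is-c i i≡t | serve-at req c =
      ≤-trans (≤-reflexive (trans (+-suc _ x) (cong (_+ x) (suc-∸1 a≥1)))) a+x≤r

    ahead⇒outer : ∀ {i : Fin n} → α + suc x ≤ toℕ i → α ≤ toℕ i
    ahead⇒outer p = ≤-trans (m≤m+n α (suc x)) p

    ahead⇒≢ : ∀ {i : Fin n} → α + suc x ≤ toℕ i → toℕ i ≢ α + x
    ahead⇒≢ p i≡ = <-irrefl (sym i≡) (≤-trans (≤-reflexive (sym (+-suc α x))) p)

    -- Case a + x = r: block t must take this element.  It then finishes exactly at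
    -- the end of its row, so the last clause of 'Row' has nothing to check.
    serve-forced : a + x ≡ r → ∃ (Served t x req)
    serve-forced a+x≡r = just c , c∈ , row′ , total′ c a≥1
      where
      a≥1 : 1 ≤ a
      a≥1 = n≢0⇒n>0 (λ a≡0 → <-irrefl (trans (cong (_+ x) (sym a≡0)) a+x≡r) x<r)
      special-shared′ : (∀ c′ → toℕ c′ ≡ t → serve (just c) req c′ ≡ 0) → ∀ i → α + suc x ≤ toℕ i →
        toℕ i < α + sp → serve (just c) req i < outerDemand (serve (just c) req)
      special-shared′ done i p q = ⊥-elim (<-irrefl 1+x≡r (special-after p q))
        where
        1+x≡r : suc x ≡ r
        1+x≡r = trans (cong (λ z → suc z + x) (sym (trans (sym (serve-at req c)) (done c c≡t))))
                      (trans (cong (_+ x) (suc-∸1 a≥1)) a+x≡r)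
      row′ : Row t (suc x) (serve (just c) req)
      row′ = record { t<α = t<α ; bounded = bounded′ (just c) ; earlier-done = earlier-done′ (just c)
                    ; block-fits = block-fits-after-c a≥1 ; special-shared = special-shared′ }

    serve-outer : (w : Fin n) → w ∈ C (t * r + x) → α ≤ toℕ w → 1 ≤ req w → a + x < r →
      (a ≡ 0 → ∀ i → i ≢ w → α + suc x ≤ toℕ i → toℕ i < α + sp → 2 + req i ≤ outerDemand req) →
      ∃ (Served t x req)
    serve-outer w w∈ α≤w w-open a+x<r spare = just w , (λ { i refl → w∈ }) , row′ , total′ w w-open
      where
      w≢c : ∀ i → toℕ i ≡ t → w ≢ i
      w≢c i i≡t w≡i = outer≢c w α≤w (trans (sym (is-c i i≡t)) (sym w≡i))
      block-untouched : ∀ i → toℕ i ≡ t → serve (just w) req i ≡ a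
      block-untouched i i≡t rewrite is-c i i≡t = serve-off req w c (w≢c c c≡t)
      drop : outerDemand (serve (just w) req) + 1 ≡ outerDemand req
      drop = outerDemand-served-outer req w α≤w w-open
      block-fits′ : ∀ i → toℕ i ≡ t → serve (just w) req i + suc x ≤ r
      block-fits′ i i≡t rewrite block-untouched i i≡t = subst (_≤ r) (sym (+-suc a x)) a+x<r
      special-shared′ : (∀ c′ → toℕ c′ ≡ t → serve (just w) req c′ ≡ 0) → ∀ i → α + suc x ≤ toℕ i →
        toℕ i < α + sp → serve (just w) req i < outerDemand (serve (just w) req)
      special-shared′ done i p q with w ≟ᶠ i
      ... | yes refl = suc≤+1⇒≤ (subst (_ ≤_) (sym drop)
            (subst (λ z → suc z ≤ outerDemand req) (sym (suc-∸1 w-open))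
              (special-shared a≡0 w (≤-trans (+-monoʳ-≤ α (n≤1+n x)) p) q)))
        where
        a≡0 : ∀ c′ → toℕ c′ ≡ t → req c′ ≡ 0
        a≡0 c′ c′≡t = trans (sym (serve-off req w c′ (w≢c c′ c′≡t))) (done c′ c′≡t)
      ... | no w≢i = suc≤+1⇒≤ (subst (_ ≤_) (sym drop)
            (spare (trans (sym (block-untouched c c≡t)) (done c c≡t)) i (λ z → w≢i (sym z)) p q))
      row′ : Row t (suc x) (serve (just w) req)
      row′ = record { t<α = t<α ; bounded = bounded′ (just w) ; earlier-done = earlier-done′ (just w)
                    ; block-fits = block-fits′ ; special-shared = special-shared′ }

    OtherSpecial : ℕ → Fin n → Set
    OtherSpecial m i = α ≤ toℕ i × toℕ i < α + sp × toℕ i ≢ α + x × m ≤ req i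

    otherSpecial? : ∀ m i → Dec (OtherSpecial m i)
    otherSpecial? m i = (α ≤? toℕ i) ×-dec (toℕ i <? α + sp) ×-dec ¬? (toℕ i ≟ α + x) ×-dec (m ≤? req i)

    OpenFull : Fin n → Set
    OpenFull i = α + sp ≤ toℕ i × 1 ≤ req i

    openFull? : ∀ i → Dec (OpenFull i)
    openFull? i = (α + sp ≤? toℕ i) ×-dec (1 ≤? req i)

    spare-from-big : ∀ w → α ≤ toℕ w → 2 ≤ req w → a ≡ 0 → ∀ i → i ≢ w → α + suc x ≤ toℕ i →
      toℕ i < α + sp → 2 + req i ≤ outerDemand req
    spare-from-big w α≤w w≥2 _ i i≢w p _ = ≤-trans (+-monoˡ-≤ (req i) w≥2)
      (subst₂ (λ u v → u + v ≤ outerDemand req) (outer-≥α req w α≤w) (outer-≥α req i (ahead⇒outer p))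
              (sumFin-two n (outer req) w i (λ z → i≢w (sym z))))

    -- … and when no other special server has demand ≥ 2: then req i ≤ 1, while
    -- counting gives outer demand ≥ r + β - x ≥ 3.
    spare-from-count : ¬ (∃ (OtherSpecial 2)) → a ≡ 0 → ∀ i → α + suc x ≤ toℕ i → toℕ i < α + sp →
      2 + req i ≤ outerDemand req
    spare-from-count no-big a≡0 i p q = +-cancelʳ-≤ x (2 + req i) (outerDemand req) (begin
      2 + req i + x                ≤⟨ +-monoˡ-≤ x (+-monoʳ-≤ 2 req-i≤1) ⟩
      suc (2 + x)                  ≤⟨ s≤s (special-after p q) ⟩
      suc r                        ≡⟨ +-comm 1 r ⟩
      r + 1                        ≤⟨ +-monoʳ-≤ r (special⇒β>0 (ahead⇒outer p) q) ⟩
      r + β                        ≤⟨ lower ⟩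
      outerDemand req + a + x      ≡⟨ cong (λ z → outerDemand req + z + x) a≡0 ⟩
      outerDemand req + 0 + x      ≡⟨ cong (_+ x) (+-identityʳ _) ⟩
      outerDemand req + x          ∎)
      where
      open ≤-Reasoning
      req-i≤1 : req i ≤ 1
      req-i≤1 = ≤-pred (≰⇒> (λ big → no-big (i , ahead⇒outer p , q , ahead⇒≢ p , big)))

    -- Otherwise no outer server except possibly the special server α + x (which
    -- does not hold the element) is open.  Then block t is still open, since the
    -- outer demand is positive and, were block t done, could not sit on α + x
    -- alone; so block t takes the element.
    serve-block : a + x < r → ¬ (∃ (OtherSpecial 1)) → ¬ (∃ OpenFull) → ∃ (Served t x req)
    serve-block a+x<r no-special no-full = just c , c∈ , row′ , total′ c a≥1
      where
      closed : ∀ i → α ≤ toℕ i → (toℕ i < α + sp → toℕ i ≢ α + x) → req i ≡ 0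
      closed i α≤i off-column with toℕ i <? α + sp
      ... | yes q = n<1⇒n≡0 (≰⇒> (λ h → no-special (i , α≤i , q , off-column q , h)))
      ... | no q = n<1⇒n≡0 (≰⇒> (λ h → no-full (i , ≮⇒≥ q , h)))
      outer-open : 1 ≤ outerDemand req
      outer-open = n≢0⇒n>0 (λ D≡0 → <⇒≱ a+x<r
        (≤-trans (m≤m+n r β) (subst (λ z → r + β ≤ z + a + x) D≡0 lower)))
      outer-rest : ∀ i → α ≤ toℕ i → toℕ i ≢ α + x → outer req i ≡ 0
      outer-rest i α≤i i≢ = trans (outer-≥α req i α≤i) (closed i α≤i (λ _ → i≢))
      block-open : a ≢ 0
      block-open a≡0 with x <? sp
      ... | yes x<sp = <-irrefl (sym outer≡s) s-shared
        where
        α+x<n : α + x < n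
        α+x<n = <-≤-trans (+-monoʳ-< α x<sp) α+sp≤n
        s : Fin n
        s = fromℕ< α+x<n
        s≡ : toℕ s ≡ α + x
        s≡ = toℕ-fromℕ< α+x<n
        α≤s : α ≤ toℕ s
        α≤s = subst (α ≤_) (sym s≡) (m≤m+n α x)
        outer≡s : outerDemand req ≡ req s
        outer≡s = trans (sumFin-single n (outer req) s only-s) (outer-≥α req s α≤s)
          where
          only-s : ∀ i → i ≢ s → outer req i ≡ 0
          only-s i i≢s with toℕ i <? α
          ... | yes i<α = outer-<α req i i<α
          ... | no i≮α = outer-rest i (≮⇒≥ i≮α) (λ e → i≢s (toℕ-injective (trans e (sym s≡))))
        s-shared : req s < outerDemand req
        s-shared = special-shared (λ c′ c′≡t → trans (cong req (is-c c′ c′≡t)) a≡0) s (≤-reflexive (sym s≡))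
                     (subst (_< α + sp) (sym s≡) (+-monoʳ-< α x<sp))
      ... | no x≮sp = <⇒≱ outer-open (≤-reflexive (sumFin-zero n outer≡0))
        where
        outer≡0 : ∀ i → outer req i ≡ 0
        outer≡0 i with toℕ i <? α
        ... | yes i<α = outer-<α req i i<α
        ... | no i≮α = trans (outer-≥α req i (≮⇒≥ i≮α))
            (closed i (≮⇒≥ i≮α) (λ q i≡ → x≮sp (+-cancelˡ-< α x sp (subst (_< α + sp) i≡ q))))
      a≥1 : 1 ≤ a
      a≥1 = n≢0⇒n>0 block-open
      special-shared′ : (∀ c′ → toℕ c′ ≡ t → serve (just c) req c′ ≡ 0) → ∀ i → α + suc x ≤ toℕ i →
        toℕ i < α + sp → serve (just c) req i < outerDemand (serve (just c) req)
      special-shared′ _ i p q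
        rewrite outerDemand-served-block req c c<α | serve-off req c i (outer≢c i (ahead⇒outer p))
              | closed i (ahead⇒outer p) (λ _ → ahead⇒≢ p) = outer-open
      row′ : Row t (suc x) (serve (just c) req)
      row′ = record { t<α = t<α ; bounded = bounded′ (just c) ; earlier-done = earlier-done′ (just c)
                    ; block-fits = block-fits-after-c a≥1 ; special-shared = special-shared′ }

    step : ∃ (Served t x req)
    step with a + x ≟ r
    ... | yes a+x≡r = serve-forced a+x≡r
    ... | no a+x≢r with ≤∧≢⇒< a+x≤r a+x≢r
    ... | a+x<r with any? (otherSpecial? 2)
    ...   | yes (w , α≤w , w<α+sp , w≢ , w≥2) =
            serve-outer w (special∈ w t x α≤w w<α+sp t<α x<r w≢) α≤w (≤-trans (s≤s z≤n) w≥2) a+x<r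
                        (spare-from-big w α≤w w≥2)
    ...   | no no-big with any? (otherSpecial? 1)
    ...     | yes (w , α≤w , w<α+sp , w≢ , w≥1) =
              serve-outer w (special∈ w t x α≤w w<α+sp t<α x<r w≢) α≤w w≥1 a+x<r
                          (λ a≡0 i _ → spare-from-count no-big a≡0 i)
    ...     | no no-special with any? openFull?
    ...       | yes (w , α+sp≤w , w≥1) =
                serve-outer w (full∈ w (t * r + x) α+sp≤w (grid<k t x t<α x<r)) (≤-trans (m≤m+n α sp) α+sp≤w)
                            w≥1 a+x<r (λ a≡0 i _ → spare-from-count no-big a≡0 i)
    ...       | no no-full = serve-block a+x<r no-special no-full

  advance : ∀ t x req → x < r → Row t (suc x) req → sumFin n req + (t * r + suc x) ≡ k →
    Inv (t * r + suc x) req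
  advance t x req x<r R total with suc x <? r
  ... | yes 1+x<r = total , inj₁ (t , suc x , refl , 1+x<r , R)
  ... | no 1+x≮r = total , next
    where
    open Row R
    1+x≡r : suc x ≡ r
    1+x≡r = ≤-antisym x<r (≮⇒≥ 1+x≮r)
    block-done : ∀ i → toℕ i ≡ t → req i ≡ 0
    block-done i i≡t = n≤0⇒n≡0 (+-cancelʳ-≤ (suc x) (req i) 0 (subst (req i + suc x ≤_) (sym 1+x≡r) (block-fits i i≡t)))
    done : ∀ i → toℕ i < suc t → req i ≡ 0
    done i i<1+t with toℕ i <? t
    ... | yes i<t = earlier-done i i<t
    ... | no i≮t = block-done i (≤-antisym (≤-pred i<1+t) (≮⇒≥ i≮t))
    y≡ : t * r + suc x ≡ suc t * r + 0
    y≡ = trans (cong (t * r +_) 1+x≡r) (trans (+-comm (t * r) r) (sym (+-identityʳ _)))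
    next : (∃₂ λ t′ x′ → t * r + suc x ≡ t′ * r + x′ × x′ < r × Row t′ x′ req) ⊎
           (α * r ≤ t * r + suc x × (∀ i → toℕ i < α → req i ≡ 0))
    next with suc t <? α
    ... | yes 1+t<α = inj₁ (suc t , 0 , y≡ , 0<r ,
            record { t<α = 1+t<α ; bounded = bounded ; earlier-done = done
                   ; block-fits = λ i _ → subst (_≤ r) (sym (+-identityʳ _)) (bounded i)
                   ; special-shared = row-start req (suc t) 1+t<α bounded done
                                        (subst (λ z → sumFin n req + z ≡ k) y≡ total) })
    ... | no 1+t≮α = inj₂ (≤-reflexive (trans (cong (_* r) α≡) (trans (sym (+-identityʳ _)) (sym y≡))) ,
                           λ i i<α → done i (subst (toℕ i <_) α≡ i<α))
      where
      α≡ : α ≡ suc t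
      α≡ = ≤-antisym (≮⇒≥ 1+t≮α) t<α

  -- One greedy step from any position before k.  In the tail, any open server
  -- is outer, hence holds the tail element.
  step-Inv : ∀ j req → j < k → Inv j req →
    ∃ λ (o : Maybe (Fin n)) → (∀ i → o ≡ just i → i ∈ C j) × Inv (suc j) (serve o req)
  step-Inv j req j<k (total , inj₁ (t , x , refl , x<r , R)) with GridStep.step t x req x<r R total
  ... | o , o∈ , R′ , total′ =
    o , o∈ , subst (λ z → Inv z (serve o req)) (+-suc (t * r) x) (advance t x (serve o req) x<r R′ total′)
  step-Inv j req j<k (total , inj₂ (αr≤j , blocks-done))
    with sumFin-pos n req (n≢0⇒n>0 (λ S≡0 → <-irrefl (trans (sym (cong (_+ j) S≡0)) total) j<k))
  ... | w , w-open =
    just w , (λ { i refl → tail∈ w j α≤w αr≤j j<k }) ,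
    (trans (+-suc _ j) (trans (cong (_+ j) (+-comm 1 _)) total′) ,
     inj₂ (≤-trans αr≤j (n≤1+n j) , λ i i<α → n≤0⇒n≡0 (≤-trans (serve-≤ (just w) req i) (≤-reflexive (blocks-done i i<α)))))
    where
    α≤w : α ≤ toℕ w
    α≤w with toℕ w <? α
    ... | yes w<α = ⊥-elim (<-irrefl (sym (blocks-done w w<α)) w-open)
    ... | no w≮α = ≮⇒≥ w≮α
    total′ : sumFin n (serve (just w) req) + 1 + j ≡ k
    total′ = trans (cong (_+ j) (total-served req w w-open)) total

  done-Inv : ∀ req → Inv k req → ∀ i → req i ≡ 0
  done-Inv req (total , _) i =
    n≤0⇒n≡0 (≤-trans (sumFin-point n req i) (≤-reflexive (+-cancelʳ-≡ k (sumFin n req) 0 total)))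

  start-Inv : ∀ req → sumFin n req ≡ k → (∀ i → req i ≤ r) → Inv 0 req
  start-Inv req size bounded = total , inj₁ (0 , 0 , refl , 0<r ,
    record { t<α = 0<α ; bounded = bounded ; earlier-done = λ i ()
           ; block-fits = λ i _ → subst (_≤ r) (sym (+-identityʳ _)) (bounded i)
           ; special-shared = row-start req 0 0<α bounded (λ i ()) total })
    where
    total : sumFin n req + 0 ≡ k
    total = trans (+-identityʳ _) size

  recover : ∀ req → sumFin n req ≡ k → (∀ i → req i ≤ r) →
    ∃ λ (D : Fin k → Maybe (Fin n)) → (∀ y i → D y ≡ just i → i ∈ C (toℕ y)) × (∀ i → req i ≤ count D i)
  recover req size bounded = greedy-cover k C Inv step-Inv done-Inv k 0 req refl (start-Inv req size bounded)

-- The servers holding element y (0-indexed) under the block family B.  'codeOf'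
-- of Defs is 'holders' at y = toℕ j, definitionally.
holders : (n : ℕ) → (ℕ → ℕ → Bool) → ℕ → Subset n
holders n B y = tabulate (λ i → B (toℕ i + 1) (y + 1))

holds : ∀ {n} B y (i : Fin n) → B (toℕ i + 1) (y + 1) ≡ true → i ∈ holders n B y
holds B y i e = lookup⇒[]= i (tabulate _) (trans (lookup∘tabulate _ i) e)

inInterval-row : ∀ r i y → inInterval r (i + 1) y ≡ ((i * r + 1 ≤ᵇ y) ∧ (y ≤ᵇ i * r + r))
inInterval-row r i y = cong (λ z → (z * r + 1 ≤ᵇ y) ∧ (y ≤ᵇ z * r + r)) (m+n∸n≡m i 1)

inInterval-own : ∀ r t x → x < r → inInterval r (t + 1) (t * r + x + 1) ≡ true
inInterval-own r t x x<r rewrite inInterval-row r t (t * r + x + 1)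
  | ≤ᵇ-true (+-monoˡ-≤ 1 (m≤m+n (t * r) x))
  | ≤ᵇ-true (subst (_≤ t * r + r) (sym (+-assoc (t * r) x 1))
                   (+-monoʳ-≤ (t * r) (subst (_≤ r) (+-comm 1 x) x<r))) = refl

row-end≤ : ∀ r {i t} → i < t → i * r + r ≤ t * r
row-end≤ r {i} {t} i<t = subst (_≤ t * r) (+-comm r (i * r)) (*-monoˡ-≤ r i<t)

inInterval-other : ∀ r t x i → i ≢ t → x < r → inInterval r (i + 1) (t * r + x + 1) ≡ false
inInterval-other r t x i i≢t x<r with <-cmp i t
... | tri≈ _ i≡t _ = ⊥-elim (i≢t i≡t)
... | tri< i<t _ _ rewrite inInterval-row r i (t * r + x + 1)
  | ≤ᵇ-false {t * r + x + 1} {i * r + r}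
      (≤-<-trans (row-end≤ r i<t) (≤-<-trans (m≤m+n (t * r) x) (m<m+n _ z<s))) = ∧-zeroʳ _
... | tri> _ _ t<i rewrite inInterval-row r i (t * r + x + 1)
  | ≤ᵇ-false {i * r + 1} {t * r + x + 1}
      (+-monoˡ-< 1 (<-≤-trans (+-monoʳ-< (t * r) x<r) (row-end≤ r t<i))) = refl

inInterval-tail : ∀ r α y i → α * r ≤ y → i < α → inInterval r (i + 1) (y + 1) ≡ false
inInterval-tail r α y i αr≤y i<α rewrite inInterval-row r i (y + 1)
  | ≤ᵇ-false {y + 1} {i * r + r} (≤-<-trans (≤-trans (row-end≤ r i<α) αr≤y) (m<m+n y z<s)) = ∧-zeroʳ _

any-false : ∀ (p : ℕ → Bool) f m → (∀ u → u < m → p (f u) ≡ false) → any p (applyUpTo f m) ≡ false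
any-false p f zero h = refl
any-false p f (suc m) h rewrite h 0 z<s = any-false p (λ u → f (suc u)) m (λ u u<m → h (suc u) (s<s u<m))

any-true : ∀ (p : ℕ → Bool) f m u → u < m → p (f u) ≡ true → any p (applyUpTo f m) ≡ true
any-true p f (suc m) zero _ e rewrite e = refl
any-true p f (suc m) (suc u) u<m e rewrite any-true p (λ u → f (suc u)) m u (≤-pred u<m) e = ∨-zeroʳ _

same-remainder : ∀ r .{{_ : NonZero r}} t u x c → t * r + x ≡ u * r + c → x < r → c < r → x ≡ c
same-remainder r t u x c e x<r c<r = begin
  x                 ≡⟨ m<n⇒m%n≡m x<r ⟨
  x % r             ≡⟨ [m+kn]%n≡m%n x t r ⟨
  (x + t * r) % r   ≡⟨ cong (_% r) (trans (+-comm x (t * r)) (trans e (+-comm (u * r) c))) ⟩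
  (c + u * r) % r   ≡⟨ [m+kn]%n≡m%n c u r ⟩
  c % r             ≡⟨ m<n⇒m%n≡m c<r ⟩
  c                 ∎
  where open ≡-Reasoning

blockI-block : ∀ α r i z → i < α → blockI α r (i + 1) z ≡ inInterval r (i + 1) z
blockI-block α r i z i<α rewrite ≤ᵇ-true (subst (_≤ α) (+-comm 1 i) i<α) = refl

blockI-full : ∀ α r i z → α ≤ i → blockI α r (i + 1) z ≡ true
blockI-full α r i z α≤i rewrite ≤ᵇ-false (subst (α <_) (+-comm 1 i) (s≤s α≤i)) = refl

blockII-block : ∀ α r i z → i < α → blockII α r (i + 1) z ≡ inInterval r (i + 1) z
blockII-block α r i z i<α rewrite ≤ᵇ-true (subst (_≤ α) (+-comm 1 i) i<α) = refl

blockII-special : ∀ α r i z → α ≤ i → i < α + r → blockII α r (i + 1) z ≡ not (inExcl α r (i + 1) z)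
blockII-special α r i z α≤i i<α+r
  rewrite ≤ᵇ-false (subst (α <_) (+-comm 1 i) (s≤s α≤i)) | ≤ᵇ-true (subst (_≤ α + r) (+-comm 1 i) i<α+r) = refl

blockII-full : ∀ α r i z → α + r ≤ i → blockII α r (i + 1) z ≡ true
blockII-full α r i z α+r≤i
  rewrite ≤ᵇ-false (subst (α <_) (+-comm 1 i) (s≤s (≤-trans (m≤m+n α r) α+r≤i)))
        | ≤ᵇ-false (subst (α + r <_) (+-comm 1 i) (s≤s α+r≤i)) = refl

-- The special server i = α + c misses exactly column c of the grid.
special-column : ∀ α i → α ≤ i → i + 1 ∸ α ≡ (i ∸ α) + 1
special-column α i α≤i = +-∸-comm 1 α≤i

special-column<r : ∀ α r i → α ≤ i → i < α + r → i ∸ α < r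
special-column<r α r i α≤i i<α+r = +-cancelˡ-< α (i ∸ α) r (subst (_< α + r) (sym (m+[n∸m]≡n α≤i)) i<α+r)

inExcl-other : ∀ r .{{_ : NonZero r}} α i t x → α ≤ i → i < α + r → x < r → i ≢ α + x →
  inExcl α r (i + 1) (t * r + x + 1) ≡ false
inExcl-other r α i t x α≤i i<α+r x<r i≢ = any-false _ (λ u → u) α (λ u _ → ≡ᵇ-false (not-excluded u))
  where
  c = i ∸ α
  not-excluded : ∀ u → t * r + x + 1 ≢ (i + 1 ∸ α) + u * r
  not-excluded u e = i≢ (trans (sym (m+[n∸m]≡n α≤i)) (cong (α +_) (sym x≡c)))
    where
    reorder : ∀ c u r → c + 1 + u * r ≡ u * r + c + 1
    reorder = solve-∀
    x≡c : x ≡ c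
    x≡c = same-remainder r t u x c
      (+-cancelʳ-≡ 1 _ _ (trans e (trans (cong (_+ u * r) (special-column α i α≤i)) (reorder c u r))))
      x<r (special-column<r α r i α≤i i<α+r)

inExcl-own : ∀ r α t x → t < α → inExcl α r (α + x + 1) (t * r + x + 1) ≡ true
inExcl-own r α t x t<α = any-true _ (λ u → u) α t t<α (T⇒≡true (≡⇒≡ᵇ _ _ (begin
  t * r + x + 1              ≡⟨ reorder t r x ⟩
  x + 1 + t * r              ≡⟨ cong (_+ t * r) (trans (cong (_∸ α) (+-assoc α x 1)) (m+n∸m≡n α (x + 1))) ⟨
  (α + x + 1 ∸ α) + t * r    ∎)))
  where
  open ≡-Reasoning
  reorder : ∀ t r x → t * r + x + 1 ≡ x + 1 + t * r
  reorder = solve-∀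

inExcl-tail : ∀ r α i y → α ≤ i → i < α + r → α * r ≤ y → inExcl α r (i + 1) (y + 1) ≡ false
inExcl-tail r α i y α≤i i<α+r αr≤y = any-false _ (λ u → u) α (λ u u<α → ≡ᵇ-false (λ e → <⇒≢ (below u u<α) (sym e)))
  where
  open ≤-Reasoning
  below : ∀ u → u < α → (i + 1 ∸ α) + u * r < y + 1
  below u u<α = begin-strict
    (i + 1 ∸ α) + u * r      ≡⟨ cong (_+ u * r) (special-column α i α≤i) ⟩
    (i ∸ α) + 1 + u * r      ≡⟨ cong (_+ u * r) (+-comm (i ∸ α) 1) ⟩
    suc (i ∸ α) + u * r      ≤⟨ +-monoˡ-≤ (u * r) (special-column<r α r i α≤i i<α+r) ⟩
    r + u * r                ≡⟨⟩
    suc u * r                ≤⟨ *-monoˡ-≤ r u<α ⟩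
    α * r                    ≤⟨ αr≤y ⟩
    y                        <⟨ m<m+n y z<s ⟩
    y + 1                    ∎

χ : Bool → ℕ
χ true = 1
χ false = 0

∣holders∣ : ∀ n B y → ∣ holders n B y ∣ ≡ sumℕ n (λ i → χ (B (i + 1) (y + 1)))
∣holders∣ n B y = trans (∣tabulate∣ n _) (sumFin-toℕ n (λ i → χ (B (i + 1) (y + 1))))
  where
  ∣tabulate∣ : ∀ n (f : Fin n → Bool) → ∣ tabulate f ∣ ≡ sumFin n (λ i → χ (f i))
  ∣tabulate∣ zero f = refl
  ∣tabulate∣ (suc n) f with f fz
  ... | true = cong suc (∣tabulate∣ n (λ i → f (fs i)))
  ... | false = ∣tabulate∣ n (λ i → f (fs i))

count-equal : ∀ n s → s < n → sumℕ n (λ i → χ (i ≡ᵇ s)) ≡ 1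
count-equal (suc n) zero _ = cong suc (trans (sumℕ-const n 0 _ (λ i _ → refl)) (*-zeroʳ n))
count-equal (suc n) (suc s) s<n = count-equal n s (≤-pred s<n)

count-from : ∀ n α → α ≤ n → sumℕ n (λ i → χ (α ≤ᵇ i)) ≡ n ∸ α
count-from n α α≤n = begin
  sumℕ n h                                         ≡⟨ cong (λ z → sumℕ z h) (m+[n∸m]≡n α≤n) ⟨
  sumℕ (α + (n ∸ α)) h                             ≡⟨ sumℕ-split α (n ∸ α) h ⟩
  sumℕ α h + sumℕ (n ∸ α) (λ i → h (α + i))
    ≡⟨ cong₂ _+_ (sumℕ-const α 0 h (λ i i<α → cong χ (≤ᵇ-false i<α)))
                 (sumℕ-const (n ∸ α) 1 _ (λ i _ → cong χ (≤ᵇ-true (m≤m+n α i)))) ⟩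
  α * 0 + (n ∸ α) * 1                              ≡⟨ cong₂ _+_ (*-zeroʳ α) (*-identityʳ _) ⟩
  n ∸ α                                            ∎
  where
  open ≡-Reasoning
  h : ℕ → ℕ
  h = λ i → χ (α ≤ᵇ i)

count-I : ∀ n α r t x → t < α → x < r → α ≤ n →
  sumℕ n (λ i → χ (blockI α r (i + 1) (t * r + x + 1))) ≡ 1 + (n ∸ α)
count-I n α r t x t<α x<r α≤n = trans (sumℕ-cong n pointwise) (trans (sumℕ-+ n _ _)
  (cong₂ _+_ (count-equal n t (<-≤-trans t<α α≤n)) (count-from n α α≤n)))
  where
  pointwise : ∀ i → χ (blockI α r (i + 1) (t * r + x + 1)) ≡ χ (i ≡ᵇ t) + χ (α ≤ᵇ i)
  pointwise i with i <? α
  ... | yes i<α rewrite blockI-block α r i (t * r + x + 1) i<α | ≤ᵇ-false i<α with i ≟ t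
  ...   | yes refl rewrite inInterval-own r i x x<r | ≡ᵇ-refl i = refl
  ...   | no i≢t rewrite inInterval-other r t x i i≢t x<r | ≡ᵇ-false i≢t = refl
  pointwise i | no i≮α rewrite blockI-full α r i (t * r + x + 1) (≮⇒≥ i≮α) | ≤ᵇ-true (≮⇒≥ i≮α)
                             | ≡ᵇ-false {i} {t} (λ i≡t → i≮α (subst (_< α) (sym i≡t) t<α)) = refl

-- Case (ii): the grid element (t,x) lies in block t and in every outer server
-- except α + x, i.e. in 1 + (n - α) - 1 servers.
count-II : ∀ n α r .{{_ : NonZero r}} t x → t < α → x < r → α + r ≤ n →
  sumℕ n (λ i → χ (blockII α r (i + 1) (t * r + x + 1))) ≡ n ∸ α
count-II n α r t x t<α x<r α+r≤n = +-cancelʳ-≡ 1 _ _ (begin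
  holding + 1                                                ≡⟨ cong (holding +_) (count-equal n (α + x) α+x<n) ⟨
  holding + sumℕ n (λ i → χ (i ≡ᵇ α + x))                    ≡⟨ sumℕ-+ n _ _ ⟨
  sumℕ n (λ i → χ (blockII α r (i + 1) (t * r + x + 1)) + χ (i ≡ᵇ α + x))
                                                             ≡⟨ sumℕ-cong n pointwise ⟩
  sumℕ n (λ i → χ (i ≡ᵇ t) + χ (α ≤ᵇ i))                     ≡⟨ sumℕ-+ n _ _ ⟩
  sumℕ n (λ i → χ (i ≡ᵇ t)) + sumℕ n (λ i → χ (α ≤ᵇ i))
    ≡⟨ cong₂ _+_ (count-equal n t (<-≤-trans t<α α≤n)) (count-from n α α≤n) ⟩
  1 + (n ∸ α)                                                ≡⟨ +-comm 1 _ ⟩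
  (n ∸ α) + 1                                                ∎)
  where
  open ≡-Reasoning
  holding : ℕ
  holding = sumℕ n (λ i → χ (blockII α r (i + 1) (t * r + x + 1)))
  α≤n : α ≤ n
  α≤n = ≤-trans (m≤m+n α r) α+r≤n
  α+x<n : α + x < n
  α+x<n = <-≤-trans (+-monoʳ-< α x<r) α+r≤n
  pointwise : ∀ i → χ (blockII α r (i + 1) (t * r + x + 1)) + χ (i ≡ᵇ α + x) ≡ χ (i ≡ᵇ t) + χ (α ≤ᵇ i)
  pointwise i with i <? α
  ... | yes i<α rewrite blockII-block α r i (t * r + x + 1) i<α | ≤ᵇ-false i<α
                      | ≡ᵇ-false {i} {α + x} (λ e → <⇒≱ i<α (subst (α ≤_) (sym e) (m≤m+n α x))) with i ≟ t
  ...   | yes refl rewrite inInterval-own r i x x<r | ≡ᵇ-refl i = refl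
  ...   | no i≢t rewrite inInterval-other r t x i i≢t x<r | ≡ᵇ-false i≢t = refl
  pointwise i | no i≮α with i <? α + r
  ... | yes i<α+r rewrite blockII-special α r i (t * r + x + 1) (≮⇒≥ i≮α) i<α+r | ≤ᵇ-true (≮⇒≥ i≮α)
                        | ≡ᵇ-false {i} {t} (λ e → i≮α (subst (_< α) (sym e) t<α)) with i ≟ α + x
  ...   | yes refl rewrite inExcl-own r α t x t<α | ≡ᵇ-refl (α + x) = refl
  ...   | no i≢ rewrite inExcl-other r α i t x (≮⇒≥ i≮α) i<α+r x<r i≢ | ≡ᵇ-false i≢ = refl
  pointwise i | no i≮α | no i≮α+r
    rewrite blockII-full α r i (t * r + x + 1) (≮⇒≥ i≮α+r) | ≤ᵇ-true (≮⇒≥ i≮α)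
          | ≡ᵇ-false {i} {t} (λ e → i≮α (subst (_< α) (sym e) t<α))
          | ≡ᵇ-false {i} {α + x} (λ e → i≮α+r (subst (_< α + r) (sym e) (+-monoʳ-< α x<r))) = refl

count-II-tail : ∀ n α r y → α * r ≤ y → α + r ≤ n →
  sumℕ n (λ i → χ (blockII α r (i + 1) (y + 1))) ≡ n ∸ α
count-II-tail n α r y αr≤y α+r≤n = trans (sumℕ-cong n pointwise) (count-from n α (≤-trans (m≤m+n α r) α+r≤n))
  where
  pointwise : ∀ i → χ (blockII α r (i + 1) (y + 1)) ≡ χ (α ≤ᵇ i)
  pointwise i with i <? α
  ... | yes i<α rewrite blockII-block α r i (y + 1) i<α | ≤ᵇ-false i<α | inInterval-tail r α y i αr≤y i<α = refl
  ... | no i≮α with i <? α + r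
  ...   | yes i<α+r rewrite blockII-special α r i (y + 1) (≮⇒≥ i≮α) i<α+r | ≤ᵇ-true (≮⇒≥ i≮α)
                          | inExcl-tail r α i y (≮⇒≥ i≮α) i<α+r αr≤y = refl
  ...   | no i≮α+r rewrite blockII-full α r i (y + 1) (≮⇒≥ i≮α+r) | ≤ᵇ-true (≮⇒≥ i≮α) = refl

grid-coords : ∀ r .{{_ : NonZero r}} α y → y < α * r → ∃₂ λ t x → y ≡ t * r + x × t < α × x < r
grid-coords r α y y<αr = y / r , y % r , trans (m≡m%n+[m/n]*n y r) (+-comm (y % r) _) , m<n*o⇒m/o<n y<αr , m%n<n y r

quotient : ∀ q r c .{{_ : NonZero r}} → c < r → (q * r + c) / r ≡ q
quotient q r c c<r =
  trans (cong (_/ r) (+-comm (q * r) c))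
        (trans (+-distrib-/-∣ʳ c (divides q refl)) (cong₂ _+_ (m<n⇒m/n≡0 c<r) (m*n/n≡m q r)))

kn∸qk : ∀ k n q → k * n ∸ q * k ≡ k * (n ∸ q)
kn∸qk k n q = trans (cong (k * n ∸_) (*-comm q k)) (sym (*-distribˡ-∸ k n q))

-- The value of N = kn - ⌊(k-1)/r⌋·k: k(1 + n - α) in case (i), since
-- k - 1 = (α-1)r + (r-1), and k(n - α) in case (ii), since k - 1 = αr + (β-1).
size-I : ∀ k r α n .{{_ : NonZero r}} → k ≡ α * r + 0 → 1 ≤ α → α ≤ n →
  k * n ∸ ((k ∸ 1) / r) * k ≡ k * (1 + (n ∸ α))
size-I k (suc r′) (suc a) (suc n′) refl _ (s≤s a≤n′) = begin
  k * suc n′ ∸ ((k ∸ 1) / suc r′) * k   ≡⟨ cong (λ q → k * suc n′ ∸ q * k) quotient-I ⟩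
  k * suc n′ ∸ a * k                    ≡⟨ kn∸qk k (suc n′) a ⟩
  k * (suc n′ ∸ a)                      ≡⟨ cong (k *_) (+-∸-assoc 1 a≤n′) ⟩
  k * (1 + (n′ ∸ a))                    ∎
  where
  open ≡-Reasoning
  quotient-I : (k ∸ 1) / suc r′ ≡ a
  quotient-I = trans (cong (_/ suc r′) (trans (+-identityʳ _) (+-comm r′ _))) (quotient a (suc r′) r′ ≤-refl)

size-II : ∀ k r α β n .{{_ : NonZero r}} → k ≡ α * r + β → 0 < β → β < r →
  k * n ∸ ((k ∸ 1) / r) * k ≡ k * (n ∸ α)
size-II k r α (suc b) n refl _ 1+b<r = begin
  k * n ∸ ((k ∸ 1) / r) * k   ≡⟨ cong (λ q → k * n ∸ q * k) quotient-II ⟩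
  k * n ∸ α * k               ≡⟨ kn∸qk k n α ⟩
  k * (n ∸ α)                 ∎
  where
  open ≡-Reasoning
  quotient-II : (k ∸ 1) / r ≡ α
  quotient-II = trans (cong (λ z → (z ∸ 1) / r) (+-suc (α * r) b)) (quotient α r b (<-trans (n<1+n b) 1+b<r))

case-I : ∀ k r α n .{{_ : NonZero r}} → k ≡ α * r + 0 → 1 ≤ α → α ≤ n →
  MCBC n (k * n ∸ ((k ∸ 1) / r) * k) k k r (codeOf n k (blockI α r))
case-I k r α n k≡ α≥1 α≤n = size , L.recover
  where
  C : ℕ → Subset n
  C = holders n (blockI α r)
  k≡αr : k ≡ α * r
  k≡αr = trans k≡ (+-identityʳ _)
  block∈ : ∀ (i : Fin n) t x → toℕ i ≡ t → t < α → x < r → i ∈ C (t * r + x)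
  block∈ i t x refl t<α x<r = holds (blockI α r) (t * r + x) i (trans (blockI-block α r (toℕ i) _ t<α) (inInterval-own r t x x<r))
  no-special : ∀ (i : Fin n) t x → α ≤ toℕ i → toℕ i < α + 0 → t < α → x < r → toℕ i ≢ α + x → i ∈ C (t * r + x)
  no-special i t x α≤i i<α _ _ _ = ⊥-elim (<⇒≱ i<α (subst (_≤ toℕ i) (sym (+-identityʳ α)) α≤i))
  no-tail : ∀ (i : Fin n) y → α ≤ toℕ i → α * r ≤ y → y < k → i ∈ C y
  no-tail i y _ αr≤y y<k = ⊥-elim (<⇒≱ y<k (subst (_≤ y) (sym k≡αr) αr≤y))
  full∈ : ∀ (i : Fin n) y → α + 0 ≤ toℕ i → y < k → i ∈ C y
  full∈ i y α≤i _ = holds (blockI α r) y i (blockI-full α r (toℕ i) _ (subst (_≤ toℕ i) (+-identityʳ α) α≤i))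
  module L = Layout n k r α 0 0 k≡ z≤n (inj₁ refl) (subst (_≤ n) (sym (+-identityʳ α)) α≤n) α≥1 (>-nonZero⁻¹ r)
               C block∈ no-special no-tail full∈
  per-element : ∀ (j : Fin k) → ∣ codeOf n k (blockI α r) j ∣ ≡ 1 + (n ∸ α)
  per-element j with grid-coords r α (toℕ j) (subst (toℕ j <_) k≡αr (toℕ<n j))
  ... | t , x , j≡ , t<α , x<r = trans (∣holders∣ n (blockI α r) (toℕ j))
        (subst (λ y → sumℕ n (λ i → χ (blockI α r (i + 1) (y + 1))) ≡ 1 + (n ∸ α)) (sym j≡) (count-I n α r t x t<α x<r α≤n))
  size : k * n ∸ ((k ∸ 1) / r) * k ≡ sumFin k (λ j → ∣ codeOf n k (blockI α r) j ∣)
  size = trans (size-I k r α n k≡ α≥1 α≤n) (sym (trans (sumFin-cong k per-element) (sumFin-const k _)))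

case-II : ∀ k r α β n .{{_ : NonZero r}} → k ≡ α * r + β → 1 ≤ α → 0 < β → β < r → α + r ≤ n →
  MCBC n (k * n ∸ ((k ∸ 1) / r) * k) k k r (codeOf n k (blockII α r))
case-II k r α β n k≡ α≥1 β>0 β<r α+r≤n = size , L.recover
  where
  C : ℕ → Subset n
  C = holders n (blockII α r)
  block∈ : ∀ (i : Fin n) t x → toℕ i ≡ t → t < α → x < r → i ∈ C (t * r + x)
  block∈ i t x refl t<α x<r = holds (blockII α r) (t * r + x) i (trans (blockII-block α r (toℕ i) _ t<α) (inInterval-own r t x x<r))
  special∈ : ∀ (i : Fin n) t x → α ≤ toℕ i → toℕ i < α + r → t < α → x < r → toℕ i ≢ α + x → i ∈ C (t * r + x)
  special∈ i t x α≤i i<α+r _ x<r i≢ = holds (blockII α r) (t * r + x) i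
    (trans (blockII-special α r (toℕ i) _ α≤i i<α+r) (cong not (inExcl-other r α (toℕ i) t x α≤i i<α+r x<r i≢)))
  tail∈ : ∀ (i : Fin n) y → α ≤ toℕ i → α * r ≤ y → y < k → i ∈ C y
  tail∈ i y α≤i αr≤y _ with toℕ i <? α + r
  ... | yes i<α+r = holds (blockII α r) y i (trans (blockII-special α r (toℕ i) _ α≤i i<α+r) (cong not (inExcl-tail r α (toℕ i) y α≤i i<α+r αr≤y)))
  ... | no i≮α+r = holds (blockII α r) y i (blockII-full α r (toℕ i) _ (≮⇒≥ i≮α+r))
  full∈ : ∀ (i : Fin n) y → α + r ≤ toℕ i → y < k → i ∈ C y
  full∈ i y α+r≤i _ = holds (blockII α r) y i (blockII-full α r (toℕ i) _ α+r≤i)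
  module L = Layout n k r α β r k≡ ≤-refl (inj₂ β>0) α+r≤n α≥1 (>-nonZero⁻¹ r) C block∈ special∈ tail∈ full∈
  per-element : ∀ (j : Fin k) → ∣ codeOf n k (blockII α r) j ∣ ≡ n ∸ α
  per-element j with toℕ j <? α * r
  ... | no j≮αr = trans (∣holders∣ n (blockII α r) (toℕ j)) (count-II-tail n α r (toℕ j) (≮⇒≥ j≮αr) α+r≤n)
  ... | yes j<αr with grid-coords r α (toℕ j) j<αr
  ...   | t , x , j≡ , t<α , x<r = trans (∣holders∣ n (blockII α r) (toℕ j))
          (subst (λ y → sumℕ n (λ i → χ (blockII α r (i + 1) (y + 1))) ≡ n ∸ α) (sym j≡) (count-II n α r t x t<α x<r α+r≤n))
  size : k * n ∸ ((k ∸ 1) / r) * k ≡ sumFin k (λ j → ∣ codeOf n k (blockII α r) j ∣)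
  size = trans (size-II k r α β n k≡ β>0 β<r) (sym (trans (sumFin-cong k per-element) (sumFin-const k _)))

theorem11 : (k r α β n : ℕ) → .{{_ : NonZero r}} → 0 < k → r ≤ k →
    k ≡ α * r + β → 1 ≤ α → β < r →
    ((β ≡ 0 → α ≤ n → MCBC n (k * n ∸ ((k ∸ 1) / r) * k) k k r (codeOf n k (blockI α r)))
    × (0 < β → α + r ≤ n → MCBC n (k * n ∸ ((k ∸ 1) / r) * k) k k r (codeOf n k (blockII α r))))
theorem11 k r α β n _ _ k≡ α≥1 β<r =
  (λ { refl α≤n → case-I k r α n k≡ α≥1 α≤n }) ,
  (λ β>0 α+r≤n → case-II k r α β n k≡ α≥1 β>0 β<r α+r≤n)
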